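{- Let $\mathcal{F}$ be a 2-generic $\mathbb{Q}_1$-filter and let $\Phi_e(G, n, m)$ be a $\Delta_0$ formula with free variables $n, m$. If $p \Vdash (\forall n)(\exists m)\neg \Phi_e(G, n, m)$ for some $p \in \mathcal{F}$, then for every $n \in \omega$ there is some $q = (\tau, Y, D, V) \in \mathcal{F}$ and some $m \in \omega$ such that $\neg\Phi_e(\tau, n, m)$ holds.
   Context: A binary string $\sigma$ is identified with the finite set $F_\sigma = \{x < |\sigma| : \sigma(x) = 1\}$; for strings, $\sigma \cup \rho$, $\tau - \sigma$ refer to these finite sets, $\rho \subseteq X$ means $F_\rho \subseteq X$, and $\sigma \preceq \tau$ is the prefix relation; $\Phi_e(\sigma, n, m)$ means the formula evaluated with $G = F_\sigma$. Fix an effective enumeration $\mathcal{U}_0, \mathcal{U}_1, \dots$ of all $\Sigma^0_1$ classes in $2^\omega$ upward closed under $\supseteq$. A largeness class is a class $\mathcal{A} \subseteq 2^\omega$ upward closed under $\supseteq$ such that for every $k$-cover $Y_0 \cup \dots \cup Y_{k-1} \supseteq \omega$ some $Y_j \in \mathcal{A}$. Let $\zeta$ be the computable function with $\mathcal{U}_{\zeta(e,\sigma,n)} = \{X : (\exists \rho \subseteq X - \{0,\dots,|\sigma|\})(\exists m)\neg\Phi_e(\sigma \cup \rho, n, m)\}$ for every index $e$ of a $\Delta_0$ formula, string $\sigma$ and $n$. $\mathbb{Q}_1$ is the set of tuples $(\sigma, X, C, U)$ ($\sigma$ a binary string, $X, C, U \subseteq \omega$) with $X \cap \{0, \dots, |\sigma|\}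 = \emptyset$, $U \subseteq X$, $\bigcap_{e \in C}\mathcal{U}_e$ a largeness class containing only infinite sets, and $U \in \bigcap_{e \in C}\mathcal{U}_e$; ordered by $(\tau, Y, D, V) \leq (\sigma, X, C, U)$ iff $\sigma \preceq \tau$, $Y \subseteq X$, $V \subseteq U$, $C \subseteq D$, $\tau - \sigma \subseteq U$. For $p = (\sigma, X, C, U)$: $p \Vdash (\exists n)(\forall m)\Phi_e(G,n,m)$ iff there is $n$ with $\Phi_e(\sigma \cup \tau, n, m)$ for every string $\tau \subseteq X$ and every $m$; $p \Vdash (\forall n)(\exists m)\neg\Phi_e(G,n,m)$ iff $\zeta(e, \sigma \cup \rho, n) \in C$ for every string $\rho \subseteq U$ and every $n$. A $\mathbb{Q}_1$-filter is a nonempty $\mathcal{F} \subseteq \mathbb{Q}_1$ upward closed under $\leq$ in which any two elements have a common lower bound in $\mathcal{F}$; it is 2-generic if for every $\Delta_0$ formula $\Phi_e(G,n,m)$ some $p \in \mathcal{F}$ satisfies $p \Vdash (\exists n)(\forall m)\Phi_e(G,n,m)$ or $p \Vdash (\forall n)(\exists m)\neg\Phi_e(G,n,m)$. -}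

module Defs where

open import Data.Nat using (ℕ; zero; suc; _+_; _*_; _≤_; _<_; _≡ᵇ_; _<ᵇ_)
open import Data.Bool using (Bool; true; false; _∧_; _∨_; not)
open import Data.Fin using (Fin)
open import Data.Vec using (Vec; []; _∷_; lookup)
open import Data.List using (List; []; _∷_; length; _++_)
open import Data.Product using (Σ; ∃; _×_; _,_)
open import Data.Sum using (_⊎_)
open import Relation.Nullary using (¬_)
open import Relation.Binary.PropositionalEquality using (_≡_)
open import Function.Bundles using (_⇔_)

SubsetOfω : Set
SubsetOfω = ℕ → Bool

Class : Set₁
Class = SubsetOfω → Set

_⊆ₛ_ : SubsetOfω → SubsetOfω → Set
X ⊆ₛ Y = ∀ x → X x ≡ true → Y x ≡ true

UpwardClosed : Class → Set
UpwardClosed 𝒜 = ∀ X Y → X ⊆ₛ Y → 𝒜 X → 𝒜 Y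

Infinite : SubsetOfω → Set
Infinite X = ∀ n → ∃ λ x → n ≤ x × X x ≡ true

IsLargeness : Class → Set
IsLargeness 𝒜 =
  UpwardClosed 𝒜 ×
  (∀ (k : ℕ) (Y : Fin k → SubsetOfω) →
     (∀ x → ∃ λ j → Y j x ≡ true) → ∃ λ j → 𝒜 (Y j))

Str : Set
Str = List Bool

-- characteristic function of F_σ = {x < |σ| : σ(x) = 1}
⟦_⟧ₛ : Str → SubsetOfω
⟦ [] ⟧ₛ x = false
⟦ b ∷ σ ⟧ₛ zero = b
⟦ b ∷ σ ⟧ₛ (suc x) = ⟦ σ ⟧ₛ x

_∪ₛ_ : Str → Str → Str
[] ∪ₛ τ = τ
(a ∷ σ) ∪ₛ [] = a ∷ σ
(a ∷ σ) ∪ₛ (b ∷ τ) = (a ∨ b) ∷ (σ ∪ₛ τ)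

_⊆str_ : Str → SubsetOfω → Set
ρ ⊆str X = ∀ x → ⟦ ρ ⟧ₛ x ≡ true → X x ≡ true

_⊆str_minus0to_ : Str → SubsetOfω → Str → Set
ρ ⊆str X minus0to σ = ∀ x → ⟦ ρ ⟧ₛ x ≡ true → (X x ≡ true × length σ < x)

_minus_⊆str_ : Str → Str → SubsetOfω → Set
τ minus σ ⊆str U = ∀ x → ⟦ τ ⟧ₛ x ≡ true → ⟦ σ ⟧ₛ x ≡ false → U x ≡ true

_≼_ : Str → Str → Set
σ ≼ τ = ∃ λ δ → τ ≡ σ ++ δ

-- Δ0 formulas of second-order arithmetic with one set variable G.
-- Fm k : formulas with k free number variables (de Bruijn, Fin k);
-- number quantifiers are bounded.

data Term (k : ℕ) : Set where
  var  : Fin k → Term k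
  `0   : Term k
  `S   : Term k → Term k
  _`+_ : Term k → Term k → Term k
  _`*_ : Term k → Term k → Term k

data Fm (k : ℕ) : Set where
  _`=_  : Term k → Term k → Fm k
  _`<_  : Term k → Term k → Fm k
  `∈G   : Term k → Fm k
  `¬    : Fm k → Fm k
  _`∧_  : Fm k → Fm k → Fm k
  _`∨_  : Fm k → Fm k → Fm k
  `∀<   : Term k → Fm (suc k) → Fm k
  `∃<   : Term k → Fm (suc k) → Fm k

evalT : ∀ {k} → Vec ℕ k → Term k → ℕ
evalT ρ (var i) = lookup ρ i
evalT ρ `0 = zero
evalT ρ (`S t) = suc (evalT ρ t)
evalT ρ (s `+ t) = evalT ρ s + evalT ρ t
evalT ρ (s `* t) = evalT ρ s * evalT ρ t

allBelow : ℕ → (ℕ → Bool) → Bool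
allBelow zero f = true
allBelow (suc b) f = allBelow b f ∧ f b

anyBelow : ℕ → (ℕ → Bool) → Bool
anyBelow zero f = false
anyBelow (suc b) f = anyBelow b f ∨ f b

evalF : ∀ {k} → SubsetOfω → Vec ℕ k → Fm k → Bool
evalF G ρ (s `= t) = evalT ρ s ≡ᵇ evalT ρ t
evalF G ρ (s `< t) = evalT ρ s <ᵇ evalT ρ t
evalF G ρ (`∈G t) = G (evalT ρ t)
evalF G ρ (`¬ φ) = not (evalF G ρ φ)
evalF G ρ (φ `∧ ψ) = evalF G ρ φ ∧ evalF G ρ ψ
evalF G ρ (φ `∨ ψ) = evalF G ρ φ ∨ evalF G ρ ψ
evalF G ρ (`∀< t φ) = allBelow (evalT ρ t) (λ x → evalF G (x ∷ ρ) φ)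
evalF G ρ (`∃< t φ) = anyBelow (evalT ρ t) (λ x → evalF G (x ∷ ρ) φ)

-- Φ_e(G, n, m) : a Δ0 formula with free variables n (index 0), m (index 1).
-- The "index e" of a Δ0 formula is represented by the formula itself.
Δ0 : Set
Δ0 = Fm 2

Holds : Δ0 → Str → ℕ → ℕ → Set
Holds e σ n m = evalF ⟦ σ ⟧ₛ (n ∷ m ∷ []) e ≡ true

IsEnumeration : (ℕ → Class) → Set
IsEnumeration 𝒰 = ∀ e → UpwardClosed (𝒰 e)

ZetaSpec : (ℕ → Class) → (Δ0 → Str → ℕ → ℕ) → Set
ZetaSpec 𝒰 ζ = ∀ e σ n X →
  𝒰 (ζ e σ n) X ⇔
    (∃ λ ρ → ρ ⊆str X minus0to σ × ∃ λ m → ¬ Holds e (σ ∪ₛ ρ) n m)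

record Cond : Set where
  constructor ⟨_,_,_,_⟩
  field
    σ : Str
    X : SubsetOfω
    C : SubsetOfω
    U : SubsetOfω

open Cond public

module Forcing (𝒰 : ℕ → Class) (ζ : Δ0 → Str → ℕ → ℕ) where

  ⋂𝒰 : SubsetOfω → Class
  ⋂𝒰 C X = ∀ e → C e ≡ true → 𝒰 e X

  InQ1 : Cond → Set
  InQ1 p =
    (∀ x → x ≤ length (σ p) → X p x ≡ false) ×
    (U p ⊆ₛ X p) ×
    IsLargeness (⋂𝒰 (C p)) ×
    (∀ Z → ⋂𝒰 (C p) Z → Infinite Z) ×
    ⋂𝒰 (C p) (U p)

  _≤Q_ : Cond → Cond → Set
  q ≤Q p =
    (σ p ≼ σ q) × (X q ⊆ₛ X p) × (U q ⊆ₛ U p) × (C p ⊆ₛ C q) ×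
    (σ q minus σ p ⊆str U p)

  _⊩Σ₂_ : Cond → Δ0 → Set
  p ⊩Σ₂ e = ∃ λ n → ∀ τ → τ ⊆str X p → ∀ m → Holds e (σ p ∪ₛ τ) n m

  _⊩Π₂_ : Cond → Δ0 → Set
  p ⊩Π₂ e = ∀ ρ → ρ ⊆str U p → ∀ n → C p (ζ e (σ p ∪ₛ ρ) n) ≡ true

  IsFilter : (Cond → Set) → Set
  IsFilter F =
    (∀ p → F p → InQ1 p) ×
    (∃ λ p → F p) ×
    (∀ p q → F q → InQ1 p → q ≤Q p → F p) ×
    (∀ p q → F p → F q → ∃ λ r → F r × r ≤Q p × r ≤Q q)

  Is2Generic : (Cond → Set) → Set
  Is2Generic F = ∀ e → ∃ λ p → F p × (p ⊩Σ₂ e ⊎ p ⊩Π₂ e)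

-- Apply 2-genericity to θ(G, a) :≡ a ∉ G ∧ (∃ m′ < a) ¬Φ_e(G ↾ a, n, m′).
-- If some r ∈ 𝓕 forces (∃a)(∀m) θ, then θ(σ_r, a) holds; cutting σ_r at a and
-- moving the rest of σ_r into X and U gives a weaker condition, hence one in 𝓕,
-- whose stem refutes Φ_e(·, n, m′).  If instead r forces (∀a)(∃m) ¬θ, let s ∈ 𝓕
-- extend both p and r.  As p forces (∀n)(∃m) ¬Φ_e, some finite K extending σ_s
-- inside U_s has ¬Φ_e(K, n, m).  Choose a > |K| + m: r then forces ¬θ at some
-- finite extension of K that adds nothing below a, yet that extension satisfies
-- θ(·, a) with witness m, a contradiction.

module Submission where

open import Defs
open import Data.Bool using (Bool; true; false; _∧_; _∨_; not)
open import Data.Bool.Properties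
  using (∨-identityʳ; ∧-identityʳ; ∨-zeroʳ; ∧-zeroʳ; ∧-conicalˡ; ∧-conicalʳ; not-injective; ¬-not; T-≡)
open import Data.Empty using (⊥-elim)
open import Data.Fin using (Fin; zero; suc)
open import Data.List using ([]; _∷_; length; take; drop)
open import Data.List.Properties using (length-take; take++drop≡id)
open import Data.Nat using (ℕ; zero; suc; _+_; _*_; _≤_; _<_; _<ᵇ_; _≡ᵇ_; z≤n; s≤s; _<?_)
open import Data.Nat.Properties
  using ( ≤-refl; ≤-reflexive; ≤-trans; <⇒≤; <⇒≱; ≮⇒≥; ≤-pred; <-irrefl; <-cmp
        ; m≤m+n; m≤n+m; n≤1+n; m⊓n≤m; m⊓n≤n; m≤n⇒m<n∨m≡n; <ᵇ⇒<; <⇒<ᵇ)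
open import Data.Product using (∃; _×_; _,_; proj₁; proj₂; uncurry)
open import Data.Sum using (_⊎_; inj₁; inj₂)
open import Data.Vec using (Vec; []; _∷_; lookup)
open import Function using (_∘_; case_of_)
open import Function.Bundles using (_⇔_; mk⇔; Equivalence)
open import Relation.Binary.Definitions using (tri<; tri≈; tri>)
open import Relation.Binary.PropositionalEquality
  using (_≡_; _≢_; refl; sym; trans; cong; cong₂)
open import Relation.Nullary using (¬_; yes; no)

∨-true : ∀ {a b} → a ∨ b ≡ true → a ≡ true ⊎ b ≡ true
∨-true {true}  _ = inj₁ refl
∨-true {false} h = inj₂ h

∨-introˡ : ∀ {a} b → a ≡ true → a ∨ b ≡ true
∨-introˡ _ refl = refl

∨-introʳ : ∀ a {b} → b ≡ true → a ∨ b ≡ true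
∨-introʳ a refl = ∨-zeroʳ a

≡true⇒≢false : ∀ {a} → a ≡ true → a ≢ false
≡true⇒≢false refl ()

∨-∧-not-absorb : ∀ {a b} → (a ≡ true → b ≡ true) → a ∨ (b ∧ not a) ≡ b
∨-∧-not-absorb {true}  {true}  _   = refl
∨-∧-not-absorb {true}  {false} a⇒b = sym (a⇒b refl)
∨-∧-not-absorb {false} {b}     _   = ∧-identityʳ b

<⇒<ᵇ≡true : ∀ {x a} → x < a → (x <ᵇ a) ≡ true
<⇒<ᵇ≡true = Equivalence.to T-≡ ∘ <⇒<ᵇ

≥⇒<ᵇ≡false : ∀ {x a} → a ≤ x → (x <ᵇ a) ≡ false
≥⇒<ᵇ≡false {x} {a} a≤x = ¬-not λ x<ᵇa → <⇒≱ (<ᵇ⇒< x a (Equivalence.from T-≡ x<ᵇa)) a≤x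

_≐_ : SubsetOfω → SubsetOfω → Set
A ≐ B = ∀ x → A x ≡ B x

_∪_ : SubsetOfω → SubsetOfω → SubsetOfω
(A ∪ B) x = A x ∨ B x

_∖_ : SubsetOfω → SubsetOfω → SubsetOfω
(A ∖ B) x = A x ∧ not (B x)

_↾_ : SubsetOfω → ℕ → SubsetOfω
(A ↾ a) x = (x <ᵇ a) ∧ A x

above : ℕ → SubsetOfω → SubsetOfω
above a A x = A x ∧ (a <ᵇ x)

Bounded : ℕ → SubsetOfω → Set
Bounded a A = ∀ x → A x ≡ true → x < a

∈∖⁻ : ∀ {A B x} → (A ∖ B) x ≡ true → A x ≡ true × B x ≡ false
∈∖⁻ {A} h = ∧-conicalˡ (A _) _ h , not-injective (∧-conicalʳ (A _) _ h)

∪-monoˡ-⊆ : ∀ {A B} D → A ⊆ₛ B → (A ∪ D) ⊆ₛ (B ∪ D)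
∪-monoˡ-⊆ D A⊆B x h with ∨-true h
... | inj₁ x∈A = ∨-introˡ (D x) (A⊆B x x∈A)
... | inj₂ x∈D = ∨-introʳ _ x∈D

Bounded-∉ : ∀ {a A} → Bounded a A → A a ≡ false
Bounded-∉ A<a = ¬-not λ a∈A → <-irrefl refl (A<a _ a∈A)

↾-≐ : ∀ {a A B} → (∀ x → x < a → A x ≡ B x) → Bounded a B → (A ↾ a) ≐ B
↾-≐ {a} {A} A≐B B<a x with x <? a
... | yes x<a = trans (cong (_∧ A x) (<⇒<ᵇ≡true x<a)) (A≐B x x<a)
... | no  x≮a = trans (cong (_∧ A x) (≥⇒<ᵇ≡false (≮⇒≥ x≮a))) (sym (¬-not (x≮a ∘ B<a x)))

above-∉↾ : ∀ {A a x} → A a ≡ false → A x ≡ true → (A ↾ a) x ≡ false → a < x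
above-∉↾ {A} {a} {x} a∉A x∈A x∉A↾a with <-cmp x a
... | tri< x<a _ _ = ⊥-elim (≡true⇒≢false (trans (cong (_∧ A x) (<⇒<ᵇ≡true x<a)) x∈A) x∉A↾a)
... | tri≈ _ refl _ = ⊥-elim (≡true⇒≢false x∈A a∉A)
... | tri> _ _ a<x = a<x

⟦∪ₛ⟧ : ∀ τ υ → ⟦ τ ∪ₛ υ ⟧ₛ ≐ (⟦ τ ⟧ₛ ∪ ⟦ υ ⟧ₛ)
⟦∪ₛ⟧ []      υ       x       = refl
⟦∪ₛ⟧ (b ∷ τ) []      x       = sym (∨-identityʳ _)
⟦∪ₛ⟧ (b ∷ τ) (c ∷ υ) zero    = refl
⟦∪ₛ⟧ (b ∷ τ) (c ∷ υ) (suc x) = ⟦∪ₛ⟧ τ υ x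

∪ₛ-identityʳ : ∀ τ → ⟦ τ ∪ₛ [] ⟧ₛ ≐ ⟦ τ ⟧ₛ
∪ₛ-identityʳ τ x = trans (⟦∪ₛ⟧ τ [] x) (∨-identityʳ _)

∈∪ₛ⁻ : ∀ τ υ {x} → ⟦ τ ∪ₛ υ ⟧ₛ x ≡ true → ⟦ τ ⟧ₛ x ≡ true ⊎ ⟦ υ ⟧ₛ x ≡ true
∈∪ₛ⁻ τ υ h = ∨-true (trans (sym (⟦∪ₛ⟧ τ υ _)) h)

∈∪ₛˡ : ∀ τ υ {x} → ⟦ τ ⟧ₛ x ≡ true → ⟦ τ ∪ₛ υ ⟧ₛ x ≡ true
∈∪ₛˡ τ υ h = trans (⟦∪ₛ⟧ τ υ _) (∨-introˡ _ h)

length-∪ₛʳ : ∀ τ υ → length υ ≤ length (τ ∪ₛ υ)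
length-∪ₛʳ []      υ       = ≤-refl
length-∪ₛʳ (b ∷ τ) []      = z≤n
length-∪ₛʳ (b ∷ τ) (c ∷ υ) = s≤s (length-∪ₛʳ τ υ)

⟦⟧-bounded : ∀ τ → Bounded (length τ) ⟦ τ ⟧ₛ
⟦⟧-bounded (b ∷ τ) zero    _ = s≤s z≤n
⟦⟧-bounded (b ∷ τ) (suc x) h = s≤s (⟦⟧-bounded τ x h)

⟦take⟧ : ∀ a τ → ⟦ take a τ ⟧ₛ ≐ (⟦ τ ⟧ₛ ↾ a)
⟦take⟧ zero    τ       x       = refl
⟦take⟧ (suc a) []      x       = sym (∧-zeroʳ _)
⟦take⟧ (suc a) (b ∷ τ) zero    = refl
⟦take⟧ (suc a) (b ∷ τ) (suc x) = ⟦take⟧ a τ x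

≼⇒⊆ : ∀ {τ υ} → τ ≼ υ → ⟦ τ ⟧ₛ ⊆ₛ ⟦ υ ⟧ₛ
≼⇒⊆ {b ∷ τ} (δ , refl) zero    h = h
≼⇒⊆ {b ∷ τ} (δ , refl) (suc x) h = ≼⇒⊆ {τ} (δ , refl) x h

toStr : ℕ → SubsetOfω → Str
toStr zero    A = []
toStr (suc L) A = A 0 ∷ toStr L (A ∘ suc)

length-toStr : ∀ L A → length (toStr L A) ≡ L
length-toStr zero    A = refl
length-toStr (suc L) A = cong suc (length-toStr L (A ∘ suc))

⟦toStr⟧ : ∀ L A → ⟦ toStr L A ⟧ₛ ≐ (A ↾ L)
⟦toStr⟧ zero    A x       = refl
⟦toStr⟧ (suc L) A zero    = refl
⟦toStr⟧ (suc L) A (suc x) = ⟦toStr⟧ L (A ∘ suc) x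

∈toStr⁻ : ∀ L A {x} → ⟦ toStr L A ⟧ₛ x ≡ true → A x ≡ true
∈toStr⁻ L A {x} h = ∧-conicalʳ (x <ᵇ L) _ (trans (sym (⟦toStr⟧ L A x)) h)

∪ₛ-toStr-∖ : ∀ τ {L A} → ⟦ τ ⟧ₛ ⊆ₛ A → Bounded L A → ⟦ τ ∪ₛ toStr L (A ∖ ⟦ τ ⟧ₛ) ⟧ₛ ≐ A
∪ₛ-toStr-∖ τ {L} {A} τ⊆A A<L x =
  trans (⟦∪ₛ⟧ τ _ x)
    (trans (cong (⟦ τ ⟧ₛ x ∨_) (trans (⟦toStr⟧ L _ x) (↾-≐ (λ _ _ → refl) A∖τ<L x)))
      (∨-∧-not-absorb (τ⊆A x)))
  where
  A∖τ<L : Bounded L (A ∖ ⟦ τ ⟧ₛ)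
  A∖τ<L y h = A<L y (∧-conicalˡ (A y) _ h)

_−ₛ_ : Str → Str → Str
τ −ₛ υ = toStr (length τ) (⟦ τ ⟧ₛ ∖ ⟦ υ ⟧ₛ)

∈−ₛ⁻ : ∀ τ υ {x} → ⟦ τ −ₛ υ ⟧ₛ x ≡ true → ⟦ τ ⟧ₛ x ≡ true × ⟦ υ ⟧ₛ x ≡ false
∈−ₛ⁻ τ υ = ∈∖⁻ {⟦ τ ⟧ₛ} {⟦ υ ⟧ₛ} ∘ ∈toStr⁻ (length τ) _

∪ₛ-−ₛ : ∀ υ τ → ⟦ υ ⟧ₛ ⊆ₛ ⟦ τ ⟧ₛ → ⟦ υ ∪ₛ (τ −ₛ υ) ⟧ₛ ≐ ⟦ τ ⟧ₛ
∪ₛ-−ₛ υ τ υ⊆τ = ∪ₛ-toStr-∖ υ υ⊆τ (⟦⟧-bounded τ)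

∪ₛ-beyond : ∀ τ ρ′ {A x} → ρ′ ⊆str A minus0to τ → x ≤ length τ → ⟦ τ ∪ₛ ρ′ ⟧ₛ x ≡ ⟦ τ ⟧ₛ x
∪ₛ-beyond τ ρ′ {x = x} ρ′-beyond x≤|τ| =
  trans (⟦∪ₛ⟧ τ ρ′ x) (trans (cong (⟦ τ ⟧ₛ x ∨_) x∉ρ′) (∨-identityʳ _))
  where
  x∉ρ′ : ⟦ ρ′ ⟧ₛ x ≡ false
  x∉ρ′ = ¬-not λ x∈ρ′ → <⇒≱ (proj₂ (ρ′-beyond x x∈ρ′)) x≤|τ|

allBelow-cong : ∀ b {c} {f g : ℕ → Bool} → b ≡ c → (∀ x → f x ≡ g x) →
  allBelow b f ≡ allBelow c g
allBelow-cong zero    refl f≡g = refl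
allBelow-cong (suc b) refl f≡g = cong₂ _∧_ (allBelow-cong b refl f≡g) (f≡g b)

anyBelow-cong : ∀ b {c} {f g : ℕ → Bool} → b ≡ c → (∀ x → f x ≡ g x) →
  anyBelow b f ≡ anyBelow c g
anyBelow-cong zero    refl f≡g = refl
anyBelow-cong (suc b) refl f≡g = cong₂ _∨_ (anyBelow-cong b refl f≡g) (f≡g b)

anyBelow⇒∃ : ∀ b {f} → anyBelow b f ≡ true → ∃ λ x → x < b × f x ≡ true
anyBelow⇒∃ (suc b) {f} h with ∨-true {anyBelow b f} h
... | inj₁ h′ with anyBelow⇒∃ b h′
...   | x , x<b , fx = x , ≤-trans x<b (n≤1+n b) , fx
anyBelow⇒∃ (suc b) h | inj₂ fb = b , ≤-refl , fb

∃⇒anyBelow : ∀ {b f x} → x < b → f x ≡ true → anyBelow b f ≡ true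
∃⇒anyBelow {suc b} {f} x<1+b fx with m≤n⇒m<n∨m≡n (≤-pred x<1+b)
... | inj₁ x<b  = ∨-introˡ (f b) (∃⇒anyBelow x<b fx)
... | inj₂ refl = ∨-introʳ (anyBelow b f) fx

evalF-cong : ∀ {k A B} → A ≐ B → (η : Vec ℕ k) (φ : Fm k) → evalF A η φ ≡ evalF B η φ
evalF-cong A≐B η (s `= t)   = refl
evalF-cong A≐B η (s `< t)   = refl
evalF-cong A≐B η (`∈G t)    = A≐B (evalT η t)
evalF-cong A≐B η (`¬ φ)     = cong not (evalF-cong A≐B η φ)
evalF-cong A≐B η (φ `∧ ψ)   = cong₂ _∧_ (evalF-cong A≐B η φ) (evalF-cong A≐B η ψ)
evalF-cong A≐B η (φ `∨ ψ)   = cong₂ _∨_ (evalF-cong A≐B η φ) (evalF-cong A≐B η ψ)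
evalF-cong A≐B η (`∀< t φ)  = allBelow-cong (evalT η t) refl λ x → evalF-cong A≐B (x ∷ η) φ
evalF-cong A≐B η (`∃< t φ)  = anyBelow-cong (evalT η t) refl λ x → evalF-cong A≐B (x ∷ η) φ

Holds-cong : ∀ e τ υ {n m} → ⟦ τ ⟧ₛ ≐ ⟦ υ ⟧ₛ → Holds e τ n m → Holds e υ n m
Holds-cong e τ υ τ≐υ h = trans (sym (evalF-cong τ≐υ _ e)) h

numeral : ∀ {k} → ℕ → Term k
numeral zero    = `0
numeral (suc n) = `S (numeral n)

evalT-numeral : ∀ {k} (η : Vec ℕ k) n → evalT η (numeral n) ≡ n
evalT-numeral η zero    = refl
evalT-numeral η (suc n) = cong suc (evalT-numeral η n)

weakenT : ∀ {k} → Term k → Term (suc k)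
weakenT (var i)  = var (suc i)
weakenT `0       = `0
weakenT (`S t)   = `S (weakenT t)
weakenT (s `+ t) = weakenT s `+ weakenT t
weakenT (s `* t) = weakenT s `* weakenT t

evalT-weakenT : ∀ {k} (η : Vec ℕ k) x t → evalT (x ∷ η) (weakenT t) ≡ evalT η t
evalT-weakenT η x (var i)  = refl
evalT-weakenT η x `0       = refl
evalT-weakenT η x (`S t)   = cong suc (evalT-weakenT η x t)
evalT-weakenT η x (s `+ t) = cong₂ _+_ (evalT-weakenT η x s) (evalT-weakenT η x t)
evalT-weakenT η x (s `* t) = cong₂ _*_ (evalT-weakenT η x s) (evalT-weakenT η x t)

Subst : ℕ → ℕ → Set
Subst k j = Fin k → Term j

substT : ∀ {k j} → Subst k j → Term k → Term j
substT θ (var i)  = θ i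
substT θ `0       = `0
substT θ (`S t)   = `S (substT θ t)
substT θ (s `+ t) = substT θ s `+ substT θ t
substT θ (s `* t) = substT θ s `* substT θ t

liftSubst : ∀ {k j} → Subst k j → Subst (suc k) (suc j)
liftSubst θ zero    = var zero
liftSubst θ (suc i) = weakenT (θ i)

Interprets : ∀ {k j} → Vec ℕ j → Subst k j → Vec ℕ k → Set
Interprets η θ ν = ∀ i → evalT η (θ i) ≡ lookup ν i

liftSubst-interprets : ∀ {k j} {η : Vec ℕ j} {θ : Subst k j} {ν} x →
  Interprets η θ ν → Interprets (x ∷ η) (liftSubst θ) (x ∷ ν)
liftSubst-interprets x θ≈ zero    = refl
liftSubst-interprets {η = η} {θ} x θ≈ (suc i) = trans (evalT-weakenT η x (θ i)) (θ≈ i)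

evalT-substT : ∀ {k j} {η : Vec ℕ j} {θ : Subst k j} {ν} →
  Interprets η θ ν → ∀ t → evalT η (substT θ t) ≡ evalT ν t
evalT-substT θ≈ (var i)  = θ≈ i
evalT-substT θ≈ `0       = refl
evalT-substT θ≈ (`S t)   = cong suc (evalT-substT θ≈ t)
evalT-substT θ≈ (s `+ t) = cong₂ _+_ (evalT-substT θ≈ s) (evalT-substT θ≈ t)
evalT-substT θ≈ (s `* t) = cong₂ _*_ (evalT-substT θ≈ s) (evalT-substT θ≈ t)

relativize : ∀ {k j} → Subst k j → Term j → Fm k → Fm j
relativize θ B (s `= t)  = substT θ s `= substT θ t
relativize θ B (s `< t)  = substT θ s `< substT θ t
relativize θ B (`∈G t)   = (substT θ t `< B) `∧ `∈G (substT θ t)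
relativize θ B (`¬ φ)    = `¬ (relativize θ B φ)
relativize θ B (φ `∧ ψ)  = relativize θ B φ `∧ relativize θ B ψ
relativize θ B (φ `∨ ψ)  = relativize θ B φ `∨ relativize θ B ψ
relativize θ B (`∀< t φ) = `∀< (substT θ t) (relativize (liftSubst θ) (weakenT B) φ)
relativize θ B (`∃< t φ) = `∃< (substT θ t) (relativize (liftSubst θ) (weakenT B) φ)

evalF-relativize : ∀ {k j} G {η : Vec ℕ j} {θ : Subst k j} {ν} {B b} →
  Interprets η θ ν → evalT η B ≡ b →
  ∀ φ → evalF G η (relativize θ B φ) ≡ evalF (G ↾ b) ν φ
evalF-relativize G θ≈ B≡b (s `= t)  = cong₂ _≡ᵇ_ (evalT-substT θ≈ s) (evalT-substT θ≈ t)
evalF-relativize G θ≈ B≡b (s `< t)  = cong₂ _<ᵇ_ (evalT-substT θ≈ s) (evalT-substT θ≈ t)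
evalF-relativize G θ≈ B≡b (`∈G t)   =
  cong₂ (λ v c → (v <ᵇ c) ∧ G v) (evalT-substT θ≈ t) B≡b
evalF-relativize G θ≈ B≡b (`¬ φ)    = cong not (evalF-relativize G θ≈ B≡b φ)
evalF-relativize G θ≈ B≡b (φ `∧ ψ)  =
  cong₂ _∧_ (evalF-relativize G θ≈ B≡b φ) (evalF-relativize G θ≈ B≡b ψ)
evalF-relativize G θ≈ B≡b (φ `∨ ψ)  =
  cong₂ _∨_ (evalF-relativize G θ≈ B≡b φ) (evalF-relativize G θ≈ B≡b ψ)
evalF-relativize G {η} {B = B} θ≈ B≡b (`∀< t φ) =
  allBelow-cong _ (evalT-substT θ≈ t) λ x → evalF-relativize G (liftSubst-interprets x θ≈)
    (trans (evalT-weakenT η x B) B≡b) φ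
evalF-relativize G {η} {B = B} θ≈ B≡b (`∃< t φ) =
  anyBelow-cong _ (evalT-substT θ≈ t) λ x → evalF-relativize G (liftSubst-interprets x θ≈)
    (trans (evalT-weakenT η x B) B≡b) φ

-- Under the ∃< of refutedBelow the variables are m′, a, m (indices 0, 1, 2);
-- Φ_e(·, n, m′) is obtained by sending Φ's variables n, m to numeral n and m′.
at-n : ℕ → Subst 2 3
at-n n zero       = numeral n
at-n n (suc zero) = var zero

-- θ from the proof; its second free variable m is a dummy.
refutedBelow : Δ0 → ℕ → Δ0
refutedBelow e n =
  `¬ (`∈G (var zero)) `∧ `∃< (var zero) (`¬ (relativize (at-n n) (var (suc zero)) e))

RefutedBelow : Δ0 → ℕ → SubsetOfω → ℕ → Set
RefutedBelow e n G a =
  G a ≡ false × ∃ λ m′ → m′ < a × evalF (G ↾ a) (n ∷ m′ ∷ []) e ≡ false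

evalF-refutedBelow : ∀ e n G a m →
  evalF G (a ∷ m ∷ []) (refutedBelow e n) ≡
  not (G a) ∧ anyBelow a (λ m′ → not (evalF (G ↾ a) (n ∷ m′ ∷ []) e))
evalF-refutedBelow e n G a m =
  cong (not (G a) ∧_) (anyBelow-cong a refl λ m′ →
    cong not (evalF-relativize G interprets refl e))
  where
  interprets : ∀ {m′} → Interprets (m′ ∷ a ∷ m ∷ []) (at-n n) (n ∷ m′ ∷ [])
  interprets zero       = evalT-numeral _ n
  interprets (suc zero) = refl

Holds-refutedBelow⇔ : ∀ e n τ a m → Holds (refutedBelow e n) τ a m ⇔ RefutedBelow e n ⟦ τ ⟧ₛ a
Holds-refutedBelow⇔ e n τ a m = mk⇔ to from
  where
  G = ⟦ τ ⟧ₛ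
  to : Holds (refutedBelow e n) τ a m → RefutedBelow e n G a
  to h with trans (sym (evalF-refutedBelow e n G a m)) h
  ... | h′ with anyBelow⇒∃ a (∧-conicalʳ (not (G a)) _ h′)
  ...   | m′ , m′<a , ¬Φ = not-injective (∧-conicalˡ _ _ h′) , m′ , m′<a , not-injective ¬Φ
  from : RefutedBelow e n G a → Holds (refutedBelow e n) τ a m
  from (a∉G , m′ , m′<a , ¬Φ) =
    trans (evalF-refutedBelow e n G a m)
      (cong₂ _∧_ (cong not a∉G) (∃⇒anyBelow m′<a (cong not ¬Φ)))

IsExtension : Cond → Str → Set
IsExtension s K = ⟦ σ s ⟧ₛ ⊆ₛ ⟦ K ⟧ₛ × K minus σ s ⊆str U s

truncate : ℕ → Cond → Cond
truncate a r =
  ⟨ take a (σ r) , X r ∪ above a ⟦ σ r ⟧ₛ , C r , U r ∪ above a ⟦ σ r ⟧ₛ ⟩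

module _ (𝒰 : ℕ → Class) (ζ : Δ0 → Str → ℕ → ℕ) where
  open Forcing 𝒰 ζ

  IsExtension-≤Q : ∀ {s r K} → s ≤Q r → IsExtension s K → IsExtension r K
  IsExtension-≤Q {s} {r} {K} (σr≼σs , _ , Us⊆Ur , _ , σs∖σr⊆Ur) (σs⊆K , K∖σs⊆Us) =
    (λ x → σs⊆K x ∘ ≼⇒⊆ σr≼σs x) , K∖σr⊆Ur
    where
    K∖σr⊆Ur : K minus σ r ⊆str U r
    K∖σr⊆Ur x x∈K x∉σr with ⟦ σ s ⟧ₛ x in x∈?σs
    ... | true  = σs∖σr⊆Ur x x∈?σs x∉σr
    ... | false = Us⊆Ur x (K∖σs⊆Us x x∈K x∈?σs)

  IsExtension-∪ₛ : ∀ {s} τ ρ → ⟦ τ ⟧ₛ ≐ ⟦ σ s ⟧ₛ → ρ ⊆str U s → IsExtension s (τ ∪ₛ ρ)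
  IsExtension-∪ₛ τ ρ τ≐σs ρ⊆Us =
    (λ x → ∈∪ₛˡ τ ρ ∘ trans (τ≐σs x)) ,
    λ x x∈τ∪ρ x∉σs → case ∈∪ₛ⁻ τ ρ x∈τ∪ρ of λ where
      (inj₁ x∈τ) → ⊥-elim (≡true⇒≢false (trans (sym (τ≐σs x)) x∈τ) x∉σs)
      (inj₂ x∈ρ) → ρ⊆Us x x∈ρ

  truncate-InQ1 : IsEnumeration 𝒰 → ∀ a r → InQ1 r → InQ1 (truncate a r)
  truncate-InQ1 enum a r (X-disjoint , U⊆X , large , infinite , U∈⋂𝒰) =
    X′-disjoint , ∪-monoˡ-⊆ _ U⊆X , large , infinite ,
    λ c c∈C → enum c (U r) _ (λ x → ∨-introˡ _) (U∈⋂𝒰 c c∈C)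
    where
    X′-disjoint : ∀ x → x ≤ length (take a (σ r)) → (X r ∪ above a ⟦ σ r ⟧ₛ) x ≡ false
    X′-disjoint x x≤|take| = cong₂ _∨_
      (X-disjoint x (≤-trans x≤a⊓|σr| (m⊓n≤n a _)))
      (trans (cong (⟦ σ r ⟧ₛ x ∧_) (≥⇒<ᵇ≡false (≤-trans x≤a⊓|σr| (m⊓n≤m a _)))) (∧-zeroʳ _))
      where
      x≤a⊓|σr| = ≤-trans x≤|take| (≤-reflexive (length-take a (σ r)))

  ≤Q-truncate : ∀ a r → ⟦ σ r ⟧ₛ a ≡ false → r ≤Q truncate a r
  ≤Q-truncate a r a∉σr =
    (drop a (σ r) , sym (take++drop≡id a (σ r))) ,
    (λ x → ∨-introˡ _) , (λ x → ∨-introˡ _) , (λ x h → h) ,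
    λ x x∈σr x∉take → ∨-introʳ (U r x) (cong₂ _∧_ x∈σr (<⇒<ᵇ≡true
      (above-∉↾ {⟦ σ r ⟧ₛ} a∉σr x∈σr (trans (sym (⟦take⟧ a (σ r) x)) x∉take))))

  ⊩Σ₂-refutedBelow⇒refutation : IsEnumeration 𝒰 → ∀ {e n r} → InQ1 r →
    r ⊩Σ₂ refutedBelow e n → ∃ λ q → InQ1 q × r ≤Q q × ∃ λ m → ¬ Holds e (σ q) n m
  ⊩Σ₂-refutedBelow⇒refutation enum {e} {n} {r} r∈Q₁ (a , r⊩)
    with Equivalence.to (Holds-refutedBelow⇔ e n (σ r) a 0)
           (Holds-cong (refutedBelow e n) (σ r ∪ₛ []) (σ r) (∪ₛ-identityʳ (σ r)) (r⊩ [] (λ _ ()) 0))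
  ... | a∉σr , m , _ , Φ-false =
    truncate a r , truncate-InQ1 enum a r r∈Q₁ , ≤Q-truncate a r a∉σr , m , ¬Φ
    where
    ¬Φ : ¬ Holds e (take a (σ r)) n m
    ¬Φ h = ≡true⇒≢false (trans (sym (evalF-cong (⟦take⟧ a (σ r)) _ e)) h) Φ-false

  module _ (zs : ZetaSpec 𝒰 ζ) where

    ⊩Π₂-refutation : ∀ {p s e} → p ⊩Π₂ e → InQ1 s → C p ⊆ₛ C s →
      ∀ ρ → ρ ⊆str U p → ∀ n →
      ∃ λ ρ′ → ρ′ ⊆str U s minus0to (σ p ∪ₛ ρ) × ∃ λ m → ¬ Holds e ((σ p ∪ₛ ρ) ∪ₛ ρ′) n m
    ⊩Π₂-refutation {s = s} p⊩ (_ , _ , _ , _ , U∈⋂𝒰) Cp⊆Cs ρ ρ⊆U n =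
      Equivalence.to (zs _ _ n (U s)) (U∈⋂𝒰 _ (Cp⊆Cs _ (p⊩ ρ ρ⊆U n)))

    ⊩Π₂⇒refuting-extension : ∀ {p s e} → p ⊩Π₂ e → InQ1 s → s ≤Q p →
      ∀ n → ∃ λ K → IsExtension s K × ∃ λ m → ¬ Holds e K n m
    ⊩Π₂⇒refuting-extension {p} {s} {e} p⊩ s∈Q₁ (σp≼σs , _ , _ , Cp⊆Cs , σs∖σp⊆Up) n
      with ⊩Π₂-refutation {p} {s} {e} p⊩ s∈Q₁ Cp⊆Cs (σ s −ₛ σ p)
             (λ x → uncurry (σs∖σp⊆Up x) ∘ ∈−ₛ⁻ (σ s) (σ p)) n
    ... | ρ₁ , ρ₁⊆Us , m , ¬Φ =
      (σ p ∪ₛ (σ s −ₛ σ p)) ∪ₛ ρ₁ ,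
      IsExtension-∪ₛ {s} (σ p ∪ₛ (σ s −ₛ σ p)) ρ₁ (∪ₛ-−ₛ (σ p) (σ s) (≼⇒⊆ σp≼σs)) (λ x → proj₁ ∘ ρ₁⊆Us x) ,
      m , ¬Φ

    ⊩Π₂-refutedBelow⇒holds : ∀ {r e n K} → InQ1 r → r ⊩Π₂ refutedBelow e n →
      IsExtension r K → ∀ m → Holds e K n m
    ⊩Π₂-refutedBelow⇒holds {r} {e} {n} {K} r∈Q₁ r⊩ (σr⊆K , K∖σr⊆Ur) m =
      ¬-not λ Φ-false →
        let ρ′ , ρ′-beyond , m′ , ¬θ =
              ⊩Π₂-refutation {r} {r} {refutedBelow e n} r⊩ r∈Q₁ (λ _ h → h) ρ ρ⊆Ur a
        in ¬θ (θ-holds Φ-false ρ′ ρ′-beyond m′)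
      where
      a : ℕ
      a = suc (length K + m)
      K<a : Bounded a ⟦ K ⟧ₛ
      K<a x x∈K = ≤-trans (⟦⟧-bounded K x x∈K) (≤-trans (m≤m+n (length K) m) (n≤1+n _))
      ρ : Str
      ρ = toStr a (⟦ K ⟧ₛ ∖ ⟦ σ r ⟧ₛ)
      ρ⊆Ur : ρ ⊆str U r
      ρ⊆Ur x = uncurry (K∖σr⊆Ur x) ∘ ∈∖⁻ {⟦ K ⟧ₛ} {⟦ σ r ⟧ₛ} ∘ ∈toStr⁻ a (⟦ K ⟧ₛ ∖ ⟦ σ r ⟧ₛ)
      a≤|σr∪ρ| : a ≤ length (σ r ∪ₛ ρ)
      a≤|σr∪ρ| = ≤-trans (≤-reflexive (sym (length-toStr a (⟦ K ⟧ₛ ∖ ⟦ σ r ⟧ₛ)))) (length-∪ₛʳ (σ r) ρ)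
      -- σ r ∪ ρ codes K and ρ′ adds nothing up to a, so the witness m < a works.
      θ-holds : evalF ⟦ K ⟧ₛ (n ∷ m ∷ []) e ≡ false →
        ∀ ρ′ → ρ′ ⊆str U r minus0to (σ r ∪ₛ ρ) →
        ∀ m′ → Holds (refutedBelow e n) ((σ r ∪ₛ ρ) ∪ₛ ρ′) a m′
      θ-holds Φ-false ρ′ ρ′-beyond m′ =
        Equivalence.from (Holds-refutedBelow⇔ e n ((σ r ∪ₛ ρ) ∪ₛ ρ′) a m′)
          ( trans (≐K a ≤-refl) (Bounded-∉ K<a) , m , s≤s (m≤n+m m (length K))
          , trans (evalF-cong (↾-≐ (λ x → ≐K x ∘ <⇒≤) K<a) _ e) Φ-false )
        where
        ≐K : ∀ x → x ≤ a → ⟦ (σ r ∪ₛ ρ) ∪ₛ ρ′ ⟧ₛ x ≡ ⟦ K ⟧ₛ x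
        ≐K x x≤a = trans (∪ₛ-beyond (σ r ∪ₛ ρ) ρ′ ρ′-beyond (≤-trans x≤a a≤|σr∪ρ|))
                         (∪ₛ-toStr-∖ (σ r) σr⊆K K<a x)

lemma2p27 : (𝒰 : ℕ → Class) (ζ : Δ0 → Str → ℕ → ℕ) →
    IsEnumeration 𝒰 → ZetaSpec 𝒰 ζ →
    (F : Cond → Set) →
    Forcing.IsFilter 𝒰 ζ F → Forcing.Is2Generic 𝒰 ζ F →
    (e : Δ0) (p : Cond) → F p → Forcing._⊩Π₂_ 𝒰 ζ p e →
    (n : ℕ) → ∃ λ q → F q × ∃ λ m → ¬ Holds e (σ q) n m
lemma2p27 𝒰 ζ enum zs F (F⊆Q₁ , _ , F-up , F-meet) generic e p p∈F p⊩ n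
  with generic (refutedBelow e n)
... | r , r∈F , inj₁ r⊩Σ₂ =
  let q , q∈Q₁ , r≤q , refutation =
        ⊩Σ₂-refutedBelow⇒refutation 𝒰 ζ enum {e} {n} (F⊆Q₁ r r∈F) r⊩Σ₂
  in q , F-up q r r∈F q∈Q₁ r≤q , refutation
... | r , r∈F , inj₂ r⊩Π₂ =
  let s , s∈F , s≤p , s≤r = F-meet p r p∈F r∈F
      K , K-extends-s , m , ¬Φ =
        ⊩Π₂⇒refuting-extension 𝒰 ζ zs {p} {s} {e} p⊩ (F⊆Q₁ s s∈F) s≤p n
  in ⊥-elim (¬Φ (⊩Π₂-refutedBelow⇒holds 𝒰 ζ zs {r} {e} {n} {K} (F⊆Q₁ r r∈F) r⊩Π₂
                   (IsExtension-≤Q 𝒰 ζ {s} {r} {K} s≤r K-extends-s) m))
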